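{- There exists a non-soluble ordered group $G$ such that for every integer $k\ge 3$ there exists a subset $S$ of $G$ with $|S|=k$, $|S^2|=4|S|-5$ and $\langle S\rangle=G$. In particular $\langle S\rangle$ is non-soluble.
   Context: An ordered group is a group $G$ with a total order $\le$ such that $a\le b$ implies $xay\le xby$ for all $a,b,x,y\in G$. For a subset $S$, $S^2=\{x_1x_2 : x_1,x_2\in S\}$, and $\langle S\rangle$ is the subgroup generated by $S$. -}

module Defs where

open import Level using (0ℓ)
open import Algebra.Bundles using (Group)
open import Data.Nat using (ℕ; zero; suc; _*_; _∸_; _≤_)
open import Data.Fin using (Fin)
open import Data.Product using (Σ; Σ-syntax; ∃; ∃-syntax; _×_; _,_)
open import Data.Unit using (⊤)
open import Relation.Binary.Core using (Rel)
open import Relation.Binary.Structures using (IsTotalOrder)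
open import Relation.Binary.PropositionalEquality using (_≡_)
open import Relation.Nullary using (¬_)

module _ (G : Group 0ℓ 0ℓ) where
  open Group G

  IsOrderedGroup : Rel Carrier 0ℓ → Set
  IsOrderedGroup _≤ᴳ_ =
    IsTotalOrder _≈_ _≤ᴳ_ ×
    (∀ a b x y → a ≤ᴳ b → ((x ∙ a) ∙ y) ≤ᴳ ((x ∙ b) ∙ y))

  data Gen (P : Carrier → Set) : Carrier → Set where
    gen-incl : ∀ {x} → P x → Gen P x
    gen-ε    : Gen P ε
    gen-∙    : ∀ {x y} → Gen P x → Gen P y → Gen P (x ∙ y)
    gen-⁻¹   : ∀ {x} → Gen P x → Gen P (x ⁻¹)
    gen-≈    : ∀ {x y} → x ≈ y → Gen P x → Gen P y

  Commutators : (Carrier → Set) → Carrier → Set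
  Commutators P x = Σ[ a ∈ Carrier ] Σ[ b ∈ Carrier ]
    (P a × P b × x ≈ (((a ⁻¹) ∙ (b ⁻¹)) ∙ a) ∙ b)

  Derived : ℕ → Carrier → Set
  Derived zero    _ = ⊤
  Derived (suc n) x = Gen (Commutators (Derived n)) x

  Soluble : Set
  Soluble = Σ[ n ∈ ℕ ] (∀ x → Derived n x → x ≈ ε)

  -- Finite subsets of size k given by an injective enumeration.
  InjectiveEnum : ∀ {k} → (Fin k → Carrier) → Set
  InjectiveEnum s = ∀ i j → s i ≈ s j → i ≡ j

  Image : ∀ {k} → (Fin k → Carrier) → Carrier → Set
  Image s x = Σ[ i ∈ _ ] x ≈ s i

  Square : ∀ {k} → (Fin k → Carrier) → Carrier → Set
  Square s x = Σ[ i ∈ _ ] Σ[ j ∈ _ ] x ≈ s i ∙ s j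

  HasSize : (Carrier → Set) → ℕ → Set
  HasSize P m = Σ[ f ∈ (Fin m → Carrier) ]
    (InjectiveEnum f × (∀ i → P (f i)) × (∀ x → P x → Σ[ i ∈ Fin m ] x ≈ f i))

-- The group is the free group F₂ on generators a (false) and b (true).
--
-- Order: the Magnus map μ sends a letter x^{±1} to (1 + X_x)^{±1} in the ring ℤ⟨⟨X_a, X_b⟩⟩ of
-- non-commutative power series.  If a reduced word is x₁^{e₁} ⋯ x_r^{e_r} with consecutive bases
-- distinct, the coefficient of X_{x₁} ⋯ X_{x_r} in its image is e₁ ⋯ e_r ≠ 0, so μ is injective.
-- Listing the monomials by degree, x < y means that the first non-zero coefficient of μ y − μ x is
-- positive; multiplying on either side by a series with constant term 1 does not change the
-- coefficients up to that degree, which gives bi-invariance.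
--
-- Non-solubility: a ↦ α = (0 1 2 3 4), b ↦ β = (0 1 3 4 2) defines an action of F₂ on five points
-- with α = [β, αβ] and β = [α, βα] (composing permutations left to right).  Iterating
-- (x, y) ↦ ([y, xy], [x, yx]) from (a, b) gives elements of every derived subgroup that still act
-- as α ≠ 1.
--
-- Small doubling: for k ≥ 3 take S = {b, 1, a, …, a^{k−2}}.  Then S² is the disjoint union of
-- {a^t : t ≤ 2k−4}, {a^q b : 1 ≤ q ≤ k−2}, {b a^q : q ≤ k−2} and {b²}, of sizes 2k−3, k−2, k−1 and 1.
module Submission where

open import Level using (0ℓ)
open import Algebra.Bundles using (Group; Monoid)
open import Algebra.Morphism.Structures using (IsMonoidHomomorphism)
open import Data.Bool using (Bool; true; false; not; if_then_else_)
open import Data.Bool.Properties using (not-involutive) renaming (_≟_ to _≟ᵇ_)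
open import Data.Empty using (⊥-elim)
open import Data.Fin using (Fin; zero; suc; toℕ)
open import Data.List using (List; []; _∷_; [_]; _++_; map; foldr; replicate; length; concatMap)
open import Data.List.Relation.Unary.Linked using (Linked; []; [-]; _∷_)
import Data.List.Relation.Unary.Linked as Linked
open import Data.Nat using (ℕ; zero; suc; _≤_; _<_; z≤n; s≤s)
import Data.Nat.Properties as ℕ
open import Data.Product using (Σ; Σ-syntax; ∃; _×_; _,_; proj₁; proj₂)
open import Data.Sum using (_⊎_; inj₁; inj₂)
open import Function using (_∘_; _on_; case_of_)
open import Relation.Binary.Core using (Rel)
open import Relation.Binary.Definitions using (DecidableEquality)
open import Relation.Binary.PropositionalEquality as ≡ using (_≡_; _≢_; _≗_)
open import Relation.Nullary using (¬_; Dec; yes; no; does)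
open import Defs

module _ {c ℓ} (M : Monoid c ℓ) where

  open Monoid M

  MutuallyInverse : Carrier → Carrier → Set ℓ
  MutuallyInverse u v = u ∙ v ≈ ε × v ∙ u ≈ ε

module FreeGroup {X : Set} (_≟_ : DecidableEquality X) where

  open ≡ using (refl; sym; trans; cong; cong₂; subst; module ≡-Reasoning)
  open import Data.List.Properties using (map-++; map-injective)
  open import Data.Product.Properties using (≡-dec)

  -- (x , true) stands for x and (x , false) for x⁻¹.
  Letter : Set
  Letter = X × Bool

  infix 8 _⁻
  _⁻ : Letter → Letter
  (x , s) ⁻ = x , not s

  ⁻-involutive : ∀ l → l ⁻ ⁻ ≡ l
  ⁻-involutive (x , s) = cong (x ,_) (not-involutive s)

  infix 4 _≟ˡ_
  _≟ˡ_ : DecidableEquality Letter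
  _≟ˡ_ = ≡-dec _≟_ _≟ᵇ_

  Word : Set
  Word = List Letter

  Reduced : Word → Set
  Reduced = Linked (λ l l′ → l′ ≢ l ⁻)

  infixr 5 _◃_
  _◃_ : Letter → Word → Word
  l ◃ [] = [ l ]
  l ◃ (l′ ∷ w) with l′ ≟ˡ l ⁻
  ... | yes _ = w
  ... | no _ = l ∷ l′ ∷ w

  infixl 7 _·_
  _·_ : Word → Word → Word
  x · y = foldr _◃_ y x

  infix 8 _⁻¹ʷ
  _⁻¹ʷ : Word → Word
  [] ⁻¹ʷ = []
  (l ∷ w) ⁻¹ʷ = w ⁻¹ʷ · [ l ⁻ ]

  ◃-reduced : ∀ l {w} → Reduced w → Reduced (l ◃ w)
  ◃-reduced l {[]} r = [-]
  ◃-reduced l {l′ ∷ w} r with l′ ≟ˡ l ⁻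
  ... | yes _ = Linked.tail r
  ... | no l′≢l⁻ = l′≢l⁻ ∷ r

  ·-reduced : ∀ x {y} → Reduced y → Reduced (x · y)
  ·-reduced [] r = r
  ·-reduced (l ∷ x) r = ◃-reduced l (·-reduced x r)

  ⁻¹ʷ-reduced : ∀ w → Reduced (w ⁻¹ʷ)
  ⁻¹ʷ-reduced [] = []
  ⁻¹ʷ-reduced (l ∷ w) = ·-reduced (w ⁻¹ʷ) [-]

  ◃-cancelˡ : ∀ l w → l ⁻ ◃ l ∷ w ≡ w
  ◃-cancelˡ l w with l ≟ˡ l ⁻ ⁻
  ... | yes _ = refl
  ... | no l≢l⁻⁻ = ⊥-elim (l≢l⁻⁻ (sym (⁻-involutive l)))

  ◃-cancelʳ : ∀ l w → l ◃ l ⁻ ∷ w ≡ w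
  ◃-cancelʳ l w with l ⁻ ≟ˡ l ⁻
  ... | yes _ = refl
  ... | no l⁻≢l⁻ = ⊥-elim (l⁻≢l⁻ refl)

  ◃-reduced-∷ : ∀ {l w} → Reduced (l ∷ w) → l ◃ w ≡ l ∷ w
  ◃-reduced-∷ {w = []} r = refl
  ◃-reduced-∷ {l} {l′ ∷ w} (l′≢l⁻ ∷ _) with l′ ≟ˡ l ⁻
  ... | yes l′≡l⁻ = ⊥-elim (l′≢l⁻ l′≡l⁻)
  ... | no _ = refl

  ◃-◃⁻ : ∀ l {w} → Reduced w → l ◃ l ⁻ ◃ w ≡ w
  ◃-◃⁻ l {[]} r = ◃-cancelʳ l []
  ◃-◃⁻ l {l′ ∷ w} r with l′ ≟ˡ l ⁻ ⁻
  ... | no _ = ◃-cancelʳ l (l′ ∷ w)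
  ... | yes l′≡l⁻⁻ = begin
    l ◃ w    ≡⟨ cong (_◃ w) (sym (trans l′≡l⁻⁻ (⁻-involutive l))) ⟩
    l′ ◃ w   ≡⟨ ◃-reduced-∷ r ⟩
    l′ ∷ w   ∎
    where open ≡-Reasoning

  ◃-· : ∀ l w {z} → Reduced z → (l ◃ w) · z ≡ l ◃ (w · z)
  ◃-· l [] r = refl
  ◃-· l (l′ ∷ w) {z} r with l′ ≟ˡ l ⁻
  ... | yes refl = sym (◃-◃⁻ l (·-reduced w r))
  ... | no _ = refl

  ·-assoc : ∀ x y {z} → Reduced z → (x · y) · z ≡ x · (y · z)
  ·-assoc [] y r = refl
  ·-assoc (l ∷ x) y r = trans (◃-· l (x · y) r) (cong (l ◃_) (·-assoc x y r))

  ·-identityʳ : ∀ {x} → Reduced x → x · [] ≡ x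
  ·-identityʳ {[]} r = refl
  ·-identityʳ {l ∷ x} r = trans (cong (l ◃_) (·-identityʳ (Linked.tail r))) (◃-reduced-∷ r)

  ⁻¹ʷ-inverseˡ : ∀ {x} → Reduced x → x ⁻¹ʷ · x ≡ []
  ⁻¹ʷ-inverseˡ {[]} r = refl
  ⁻¹ʷ-inverseˡ {l ∷ x} r = begin
    (x ⁻¹ʷ · [ l ⁻ ]) · (l ∷ x)   ≡⟨ ·-assoc (x ⁻¹ʷ) [ l ⁻ ] r ⟩
    x ⁻¹ʷ · (l ⁻ ◃ l ∷ x)         ≡⟨ cong (x ⁻¹ʷ ·_) (◃-cancelˡ l x) ⟩
    x ⁻¹ʷ · x                     ≡⟨ ⁻¹ʷ-inverseˡ (Linked.tail r) ⟩
    []                            ∎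
    where open ≡-Reasoning

  ⁻¹ʷ-inverseʳ : ∀ {x} → Reduced x → x · x ⁻¹ʷ ≡ []
  ⁻¹ʷ-inverseʳ {[]} r = refl
  ⁻¹ʷ-inverseʳ {l ∷ x} r = begin
    l ◃ x · (x ⁻¹ʷ · [ l ⁻ ])   ≡⟨ cong (l ◃_) (sym (·-assoc x (x ⁻¹ʷ) [-])) ⟩
    l ◃ (x · x ⁻¹ʷ) · [ l ⁻ ]   ≡⟨ cong (λ w → l ◃ w · [ l ⁻ ]) (⁻¹ʷ-inverseʳ (Linked.tail r)) ⟩
    l ◃ [ l ⁻ ]                 ≡⟨ ◃-cancelʳ l [] ⟩
    []                          ∎
    where open ≡-Reasoning

  freeGroup : Group 0ℓ 0ℓ
  freeGroup = record
    { Carrier = Σ Word Reduced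
    ; _≈_ = λ x y → proj₁ x ≡ proj₁ y
    ; _∙_ = λ (x , _) (y , ry) → x · y , ·-reduced x ry
    ; ε = [] , []
    ; _⁻¹ = λ (x , _) → x ⁻¹ʷ , ⁻¹ʷ-reduced x
    ; isGroup = record
      { isMonoid = record
        { isSemigroup = record
          { isMagma = record
            { isEquivalence = record { refl = refl ; sym = sym ; trans = trans }
            ; ∙-cong = cong₂ _·_
            }
          ; assoc = λ (x , _) (y , _) (_ , rz) → ·-assoc x y rz
          }
        ; identity = (λ _ → refl) , (λ (_ , rx) → ·-identityʳ rx)
        }
      ; inverse = (λ (_ , rx) → ⁻¹ʷ-inverseˡ rx) , (λ (_ , rx) → ⁻¹ʷ-inverseʳ rx)
      ; ⁻¹-cong = cong _⁻¹ʷ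
      }
    }

  module Lift {c ℓ} (M : Monoid c ℓ) (g g⁻ : X → Monoid.Carrier M)
              (g-inverse : ∀ x → MutuallyInverse M (g x) (g⁻ x)) where

    open Monoid M using (Carrier; _≈_; _∙_; ε)

    ⟦_⟧ˡ : Letter → Carrier
    ⟦ x , true ⟧ˡ = g x
    ⟦ x , false ⟧ˡ = g⁻ x

    ⟦_⟧ : Word → Carrier
    ⟦ [] ⟧ = ε
    ⟦ l ∷ w ⟧ = ⟦ l ⟧ˡ ∙ ⟦ w ⟧

    ⟦⟧ˡ-inverse : ∀ l → ⟦ l ⟧ˡ ∙ ⟦ l ⁻ ⟧ˡ ≈ ε
    ⟦⟧ˡ-inverse (x , true) = proj₁ (g-inverse x)
    ⟦⟧ˡ-inverse (x , false) = proj₂ (g-inverse x)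

    private
      module M = Monoid M
    open import Relation.Binary.Reasoning.Setoid M.setoid

    ⟦◃⟧ : ∀ l w → ⟦ l ◃ w ⟧ ≈ ⟦ l ⟧ˡ ∙ ⟦ w ⟧
    ⟦◃⟧ l [] = M.refl
    ⟦◃⟧ l (l′ ∷ w) with l′ ≟ˡ l ⁻
    ... | no _ = M.refl
    ... | yes refl = begin
      ⟦ w ⟧                          ≈⟨ M.identityˡ _ ⟨
      ε ∙ ⟦ w ⟧                      ≈⟨ M.∙-congʳ (⟦⟧ˡ-inverse l) ⟨
      (⟦ l ⟧ˡ ∙ ⟦ l ⁻ ⟧ˡ) ∙ ⟦ w ⟧    ≈⟨ M.assoc _ _ _ ⟩
      ⟦ l ⟧ˡ ∙ (⟦ l ⁻ ⟧ˡ ∙ ⟦ w ⟧)    ∎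

    ⟦·⟧ : ∀ x y → ⟦ x · y ⟧ ≈ ⟦ x ⟧ ∙ ⟦ y ⟧
    ⟦·⟧ [] y = M.sym (M.identityˡ _)
    ⟦·⟧ (l ∷ x) y = begin
      ⟦ l ◃ x · y ⟧               ≈⟨ ⟦◃⟧ l (x · y) ⟩
      ⟦ l ⟧ˡ ∙ ⟦ x · y ⟧          ≈⟨ M.∙-congˡ (⟦·⟧ x y) ⟩
      ⟦ l ⟧ˡ ∙ (⟦ x ⟧ ∙ ⟦ y ⟧)    ≈⟨ M.assoc _ _ _ ⟨
      (⟦ l ⟧ˡ ∙ ⟦ x ⟧) ∙ ⟦ y ⟧    ∎

    ⟦++⟧ : ∀ x y → ⟦ x ++ y ⟧ ≈ ⟦ x ⟧ ∙ ⟦ y ⟧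
    ⟦++⟧ [] y = M.sym (M.identityˡ _)
    ⟦++⟧ (l ∷ x) y = M.trans (M.∙-congˡ (⟦++⟧ x y)) (M.sym (M.assoc _ _ _))

    lift : Group.Carrier freeGroup → Carrier
    lift (w , _) = ⟦ w ⟧

    lift-isMonoidHomomorphism :
      IsMonoidHomomorphism (Group.rawMonoid freeGroup) M.rawMonoid lift
    lift-isMonoidHomomorphism = record
      { isMagmaHomomorphism = record
        { isRelHomomorphism = record { cong = λ x≡y → M.reflexive (cong ⟦_⟧ x≡y) }
        ; homo = λ (x , _) (y , _) → ⟦·⟧ x y
        }
      ; ε-homo = M.refl
      }

  open Group freeGroup using (Carrier; _≈_; _∙_)

  ·-++ : ∀ x {y} → Reduced (x ++ y) → x · y ≡ x ++ y
  ·-++ [] r = refl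
  ·-++ (l ∷ x) r = trans (cong (l ◃_) (·-++ x (Linked.tail r))) (◃-reduced-∷ r)

  positive-reduced : ∀ xs → Reduced (map (_, true) xs)
  positive-reduced [] = []
  positive-reduced (x ∷ []) = [-]
  positive-reduced (x ∷ y ∷ xs) = (λ ()) ∷ positive-reduced (y ∷ xs)

  positive : List X → Carrier
  positive xs = map (_, true) xs , positive-reduced xs

  positive-∙ : ∀ xs ys → positive xs ∙ positive ys ≈ positive (xs ++ ys)
  positive-∙ xs ys =
    trans (·-++ (map (_, true) xs) (subst Reduced (map-++ (_, true) xs ys) (positive-reduced (xs ++ ys))))
          (sym (map-++ (_, true) xs ys))

  positive-injective : ∀ {xs ys} → positive xs ≈ positive ys → xs ≡ ys
  positive-injective = map-injective (cong proj₁)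

  generator : X → Carrier
  generator x = [ x , true ] , [-]

  generated-by-generators : ∀ {P} → (∀ x → Gen freeGroup P (generator x)) →
                            ∀ g → Gen freeGroup P g
  generated-by-generators {P} gen-x = λ (w , r) → word w r
    where
    letter : ∀ l → Gen freeGroup P ([ l ] , [-])
    letter (x , true) = gen-x x
    letter (x , false) = gen-⁻¹ (gen-x x)

    word : ∀ w (r : Reduced w) → Gen freeGroup P (w , r)
    word [] [] = gen-ε
    word (l ∷ w) r = gen-≈ (◃-reduced-∷ r) (gen-∙ (letter l) (word w (Linked.tail r)))

module FormalSeries (X : Set) where

  open ≡ using (refl; sym; trans; cong; cong₂; module ≡-Reasoning)
  open import Data.Integer using (ℤ; _+_; _*_; _-_; 0ℤ; 1ℤ; _≟_)
  open import Data.Integer.Properties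
    using (*-identityˡ; *-identityʳ; *-zeroʳ; +-identityˡ; +-identityʳ; *-assoc; *-distribʳ-+)
  open import Data.Integer.Tactic.RingSolver using (solve-∀)

  Monomial : Set
  Monomial = List X

  Series : Set
  Series = Monomial → ℤ

  𝟙 : Series
  𝟙 [] = 1ℤ
  𝟙 (_ ∷ _) = 0ℤ

  ∂ : X → Series → Series
  ∂ c f m = f (c ∷ m)

  infixl 6 _⊕_ _⊖_
  _⊕_ _⊖_ : Series → Series → Series
  (f ⊕ g) m = f m + g m
  (f ⊖ g) m = f m - g m

  infixr 7 _•_
  _•_ : ℤ → Series → Series
  (k • f) m = k * f m

  infixl 7 _⊛_
  _⊛_ : Series → Series → Series
  (f ⊛ g) [] = f [] * g []
  (f ⊛ g) (c ∷ m) = f [] * g (c ∷ m) + (∂ c f ⊛ g) m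

  ⊛-cong : ∀ {f f′ g g′} → f ≗ f′ → g ≗ g′ → f ⊛ g ≗ f′ ⊛ g′
  ⊛-cong f≗f′ g≗g′ [] = cong₂ _*_ (f≗f′ []) (g≗g′ [])
  ⊛-cong f≗f′ g≗g′ (c ∷ m) =
    cong₂ _+_ (cong₂ _*_ (f≗f′ []) (g≗g′ (c ∷ m))) (⊛-cong (λ m′ → f≗f′ (c ∷ m′)) g≗g′ m)

  ⊛-zeroˡ : ∀ {f} g → f ≗ (λ _ → 0ℤ) → f ⊛ g ≗ (λ _ → 0ℤ)
  ⊛-zeroˡ g f≗0 [] rewrite f≗0 [] = refl
  ⊛-zeroˡ g f≗0 (c ∷ m) rewrite f≗0 [] | ⊛-zeroˡ g (λ m′ → f≗0 (c ∷ m′)) m = refl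

  ⊛-distribʳ-⊕ : ∀ f f′ g → (f ⊕ f′) ⊛ g ≗ f ⊛ g ⊕ f′ ⊛ g
  ⊛-distribʳ-⊕ f f′ g [] = *-distribʳ-+ (g []) (f []) (f′ [])
  ⊛-distribʳ-⊕ f f′ g (c ∷ m) rewrite ⊛-distribʳ-⊕ (∂ c f) (∂ c f′) g m =
    lemma (f []) (f′ []) (g (c ∷ m)) _ _
    where
    lemma : ∀ a b c d e → (a + b) * c + (d + e) ≡ (a * c + d) + (b * c + e)
    lemma = solve-∀

  ⊛-distribʳ-⊖ : ∀ f f′ g → (f ⊖ f′) ⊛ g ≗ f ⊛ g ⊖ f′ ⊛ g
  ⊛-distribʳ-⊖ f f′ g [] = lemma (f []) (f′ []) (g [])
    where
    lemma : ∀ a b c → (a - b) * c ≡ a * c - b * c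
    lemma = solve-∀
  ⊛-distribʳ-⊖ f f′ g (c ∷ m) rewrite ⊛-distribʳ-⊖ (∂ c f) (∂ c f′) g m =
    lemma (f []) (f′ []) (g (c ∷ m)) _ _
    where
    lemma : ∀ a b c d e → (a - b) * c + (d - e) ≡ (a * c + d) - (b * c + e)
    lemma = solve-∀

  ⊛-distribˡ-⊖ : ∀ f g g′ → f ⊛ (g ⊖ g′) ≗ f ⊛ g ⊖ f ⊛ g′
  ⊛-distribˡ-⊖ f g g′ [] = lemma (f []) (g []) (g′ [])
    where
    lemma : ∀ a b c → a * (b - c) ≡ a * b - a * c
    lemma = solve-∀
  ⊛-distribˡ-⊖ f g g′ (c ∷ m) rewrite ⊛-distribˡ-⊖ (∂ c f) g g′ m =
    lemma (f []) (g (c ∷ m)) (g′ (c ∷ m)) _ _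
    where
    lemma : ∀ a b c d e → a * (b - c) + (d - e) ≡ (a * b + d) - (a * c + e)
    lemma = solve-∀

  •-⊛ : ∀ k f g → (k • f) ⊛ g ≗ k • (f ⊛ g)
  •-⊛ k f g [] = *-assoc k (f []) (g [])
  •-⊛ k f g (c ∷ m) rewrite •-⊛ k (∂ c f) g m = lemma k (f []) (g (c ∷ m)) _
    where
    lemma : ∀ k a b c → (k * a) * b + k * c ≡ k * (a * b + c)
    lemma = solve-∀

  ⊛-assoc : ∀ f g h → (f ⊛ g) ⊛ h ≗ f ⊛ (g ⊛ h)
  ⊛-assoc f g h [] = *-assoc (f []) (g []) (h [])
  ⊛-assoc f g h (c ∷ m) = begin
    (f [] * g []) * h (c ∷ m) + ((f [] • ∂ c g ⊕ ∂ c f ⊛ g) ⊛ h) m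
      ≡⟨ cong (head +_) (⊛-distribʳ-⊕ (f [] • ∂ c g) (∂ c f ⊛ g) h m) ⟩
    (f [] * g []) * h (c ∷ m) + (((f [] • ∂ c g) ⊛ h) m + (∂ c f ⊛ g ⊛ h) m)
      ≡⟨ cong (head +_) (cong₂ _+_ (•-⊛ (f []) (∂ c g) h m) (⊛-assoc (∂ c f) g h m)) ⟩
    (f [] * g []) * h (c ∷ m) + (f [] * (∂ c g ⊛ h) m + (∂ c f ⊛ (g ⊛ h)) m)
      ≡⟨ lemma (f []) (g []) (h (c ∷ m)) _ _ ⟩
    f [] * (g [] * h (c ∷ m) + (∂ c g ⊛ h) m) + (∂ c f ⊛ (g ⊛ h)) m
      ∎
    where
    open ≡-Reasoning
    head = (f [] * g []) * h (c ∷ m)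
    lemma : ∀ a b c d e → (a * b) * c + (a * d + e) ≡ a * (b * c + d) + e
    lemma = solve-∀

  ⊛-identityˡ : ∀ g → 𝟙 ⊛ g ≗ g
  ⊛-identityˡ g [] = *-identityˡ (g [])
  ⊛-identityˡ g (c ∷ m) rewrite ⊛-zeroˡ {∂ c 𝟙} g (λ _ → refl) m =
    trans (+-identityʳ _) (*-identityˡ (g (c ∷ m)))

  ⊛-identityʳ : ∀ f → f ⊛ 𝟙 ≗ f
  ⊛-identityʳ f [] = *-identityʳ (f [])
  ⊛-identityʳ f (c ∷ m) rewrite ⊛-identityʳ (∂ c f) m =
    trans (cong (_+ f (c ∷ m)) (*-zeroʳ (f []))) (+-identityˡ (f (c ∷ m)))

  ⊛-≢0⇒≢0ˡ : ∀ f g m → (f ⊛ g) m ≢ 0ℤ → ∃ λ m′ → f m′ ≢ 0ℤ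
  ⊛-≢0⇒≢0ˡ f g [] fg≢0 = [] , λ f[]≡0 → fg≢0 (cong (_* g []) f[]≡0)
  ⊛-≢0⇒≢0ˡ f g (c ∷ m) fg≢0 with f [] ≟ 0ℤ
  ... | no f[]≢0 = [] , f[]≢0
  ... | yes f[]≡0
    with ⊛-≢0⇒≢0ˡ (∂ c f) g m (λ ∂fg≡0 → fg≢0 (cong₂ (λ a b → a * g (c ∷ m) + b) f[]≡0 ∂fg≡0))
  ... | m′ , ∂f≢0 = c ∷ m′ , ∂f≢0

  ⊛-monoid : Monoid 0ℓ 0ℓ
  ⊛-monoid = record
    { Carrier = Series
    ; _≈_ = _≗_
    ; _∙_ = _⊛_
    ; ε = 𝟙
    ; isMonoid = record
      { isSemigroup = record
        { isMagma = record
          { isEquivalence = record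
            { refl = λ _ → refl
            ; sym = λ f≗g m → sym (f≗g m)
            ; trans = λ f≗g g≗h m → trans (f≗g m) (g≗h m)
            }
          ; ∙-cong = ⊛-cong
          }
        ; assoc = ⊛-assoc
        }
      ; identity = ⊛-identityˡ , ⊛-identityʳ
      }
    }

module Magnus {X : Set} (_≟_ : DecidableEquality X) where

  open ≡ using (refl; sym; trans; cong; cong₂; module ≡-Reasoning)
  open import Algebra.Properties.Group using (x∙y⁻¹≈ε⇒x≈y)
  open import Data.Integer using (ℤ; _+_; _*_; -_; _-_; 0ℤ; 1ℤ; +[1+_]; -[1+_])
  open import Data.Integer.Properties
    using (*-zeroʳ; +-identityˡ; +-identityʳ; -1*i≡-i; i*j≡0⇒i≡0∨j≡0; i-j≡0⇒i≡j; i≡j⇒i-j≡0)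
  open import Data.Integer.Tactic.RingSolver using (solve-∀)
  open import Data.List.Properties using (length-map)
  open import Data.List.Relation.Unary.All using (All; []; _∷_)
  open import Data.List.Relation.Unary.Linked.Properties using (map⁺)

  open FormalSeries X
  open FreeGroup _≟_

  1+X : X → Series
  1+X c [] = 1ℤ
  1+X c (d ∷ []) = if does (c ≟ d) then 1ℤ else 0ℤ
  1+X c (_ ∷ _ ∷ _) = 0ℤ

  [1+X]⁻¹ : X → Series
  [1+X]⁻¹ c [] = 1ℤ
  [1+X]⁻¹ c (d ∷ m) = if does (c ≟ d) then - [1+X]⁻¹ c m else 0ℤ

  InPowersOf : X → Series → Set
  InPowersOf c f = ∀ {m} → ¬ All (c ≡_) m → f m ≡ 0ℤ

  1+X-inPowers : ∀ c → InPowersOf c (1+X c)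
  1+X-inPowers c {[]} ¬all = ⊥-elim (¬all [])
  1+X-inPowers c {d ∷ []} ¬all with c ≟ d
  ... | yes c≡d = ⊥-elim (¬all (c≡d ∷ []))
  ... | no _ = refl
  1+X-inPowers c {_ ∷ _ ∷ _} ¬all = refl

  [1+X]⁻¹-inPowers : ∀ c → InPowersOf c ([1+X]⁻¹ c)
  [1+X]⁻¹-inPowers c {[]} ¬all = ⊥-elim (¬all [])
  [1+X]⁻¹-inPowers c {d ∷ m} ¬all with c ≟ d
  ... | yes c≡d = cong -_ ([1+X]⁻¹-inPowers c (λ all → ¬all (c≡d ∷ all)))
  ... | no _ = refl

  ∂-inPowers-other : ∀ {c d f} → InPowersOf c f → c ≢ d → ∂ d f ≗ (λ _ → 0ℤ)
  ∂-inPowers-other pf c≢d m = pf λ { (c≡d ∷ _) → c≢d c≡d }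

  ∂-inPowers-same : ∀ {c f} → InPowersOf c f → InPowersOf c (∂ c f)
  ∂-inPowers-same pf ¬all = pf λ { (_ ∷ all) → ¬all all }

  ⊛-inPowers : ∀ {c f g} → InPowersOf c f → InPowersOf c g → InPowersOf c (f ⊛ g)
  ⊛-inPowers pf pg {[]} ¬all = ⊥-elim (¬all [])
  ⊛-inPowers {c} {f} {g} pf pg {d ∷ m} ¬all =
    trans (cong₂ (λ a b → f [] * a + b) (pg ¬all) tail≡0) (trans (+-identityʳ _) (*-zeroʳ (f [])))
    where
    tail≡0 : (∂ d f ⊛ g) m ≡ 0ℤ
    tail≡0 with c ≟ d
    ... | yes refl = ⊛-inPowers (∂-inPowers-same pf) pg (λ all → ¬all (refl ∷ all))
    ... | no c≢d = ⊛-zeroˡ g (∂-inPowers-other pf c≢d) m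

  if-≟-refl : ∀ c {A : Set} {a b : A} → (if does (c ≟ c) then a else b) ≡ a
  if-≟-refl c with c ≟ c
  ... | yes _ = refl
  ... | no c≢c = ⊥-elim (c≢c refl)

  ∂-1+X : ∀ c → ∂ c (1+X c) ≗ 𝟙
  ∂-1+X c [] = if-≟-refl c
  ∂-1+X c (_ ∷ _) = refl

  1+X-inverseʳ : ∀ c → 1+X c ⊛ [1+X]⁻¹ c ≗ 𝟙
  1+X-inverseʳ c [] = refl
  1+X-inverseʳ c (d ∷ m) with c ≟ d
  ... | yes refl = begin
    1ℤ * - [1+X]⁻¹ c m + (∂ c (1+X c) ⊛ [1+X]⁻¹ c) m
      ≡⟨ cong (1ℤ * - [1+X]⁻¹ c m +_) (trans (⊛-cong (∂-1+X c) (λ _ → refl) m) (⊛-identityˡ _ m)) ⟩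
    1ℤ * - [1+X]⁻¹ c m + [1+X]⁻¹ c m
      ≡⟨ lemma ([1+X]⁻¹ c m) ⟩
    0ℤ ∎
    where
    open ≡-Reasoning
    lemma : ∀ a → 1ℤ * - a + a ≡ 0ℤ
    lemma = solve-∀
  ... | no c≢d = cong (1ℤ * 0ℤ +_) (⊛-zeroˡ ([1+X]⁻¹ c) (∂-inPowers-other (1+X-inPowers c) c≢d) m)

  1+X-inverseˡ : ∀ c → [1+X]⁻¹ c ⊛ 1+X c ≗ 𝟙
  1+X-inverseˡ c [] = refl
  1+X-inverseˡ c (d ∷ m) with c ≟ d
  ... | yes refl = begin
    1ℤ * 1+X c (c ∷ m) + ((λ m′ → - [1+X]⁻¹ c m′) ⊛ 1+X c) m
      ≡⟨ cong₂ (λ a b → 1ℤ * a + b) (∂-1+X c m)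
               (trans (⊛-cong (λ m′ → sym (-1*i≡-i _)) (λ _ → refl) m)
                      (•-⊛ (- 1ℤ) ([1+X]⁻¹ c) (1+X c) m)) ⟩
    1ℤ * 𝟙 m + - 1ℤ * ([1+X]⁻¹ c ⊛ 1+X c) m
      ≡⟨ cong (λ a → 1ℤ * 𝟙 m + - 1ℤ * a) (1+X-inverseˡ c m) ⟩
    1ℤ * 𝟙 m + - 1ℤ * 𝟙 m
      ≡⟨ lemma (𝟙 m) ⟩
    0ℤ ∎
    where
    open ≡-Reasoning
    lemma : ∀ a → 1ℤ * a + - 1ℤ * a ≡ 0ℤ
    lemma = solve-∀
  ... | no c≢d = cong₂ (λ a b → 1ℤ * a + b) (1+X-inPowers c {d ∷ m} λ { (c≡d ∷ _) → c≢d c≡d })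
                   (⊛-zeroˡ (1+X c) (λ _ → refl) m)

  open Lift ⊛-monoid 1+X [1+X]⁻¹ (λ c → 1+X-inverseʳ c , 1+X-inverseˡ c) public
    renaming (⟦_⟧ to magnus; ⟦_⟧ˡ to magnusˡ; ⟦·⟧ to magnus-·; ⟦++⟧ to magnus-++)
    using ()

  magnusˡ-constant : ∀ l → magnusˡ l [] ≡ 1ℤ
  magnusˡ-constant (_ , true) = refl
  magnusˡ-constant (_ , false) = refl

  magnus-constant : ∀ w → magnus w [] ≡ 1ℤ
  magnus-constant [] = refl
  magnus-constant (l ∷ w) = cong₂ _*_ (magnusˡ-constant l) (magnus-constant w)

  magnusˡ-inPowers : ∀ l → InPowersOf (proj₁ l) (magnusˡ l)
  magnusˡ-inPowers (c , true) = 1+X-inPowers c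
  magnusˡ-inPowers (c , false) = [1+X]⁻¹-inPowers c

  𝟙-inPowers : ∀ c → InPowersOf c 𝟙
  𝟙-inPowers c {[]} ¬all = ⊥-elim (¬all [])
  𝟙-inPowers c {_ ∷ _} ¬all = refl

  ⊛-inPowers-other : ∀ {c d f} g {m} → InPowersOf c f → c ≢ d →
                     (f ⊛ g) (d ∷ m) ≡ f [] * g (d ∷ m)
  ⊛-inPowers-other {f = f} g {m} pf c≢d =
    trans (cong (f [] * g (_ ∷ m) +_) (⊛-zeroˡ g (∂-inPowers-other pf c≢d) m)) (+-identityʳ _)

  ⊛-inPowers-same : ∀ {c f} g {m} → InPowersOf c f → Linked _≢_ (c ∷ m) →
                    (f ⊛ g) (c ∷ m) ≡ f [] * g (c ∷ m) + f [ c ] * g m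
  ⊛-inPowers-same g {[]} pf alt = refl
  ⊛-inPowers-same {c} {f} g {d ∷ m} pf (c≢d ∷ _) =
    cong (f [] * g (c ∷ d ∷ m) +_)
      (trans (cong (f [ c ] * g (d ∷ m) +_)
                   (⊛-zeroˡ g (∂-inPowers-other (∂-inPowers-same pf) c≢d) m))
             (+-identityʳ _))

  Syllable : Set
  Syllable = Letter × ℕ

  base : Syllable → X
  base ((x , _) , _) = x

  power : Syllable → Word
  power (l , n) = replicate (suc n) l

  exponent : Syllable → ℤ
  exponent ((_ , true) , n) = +[1+ n ]
  exponent ((_ , false) , n) = -[1+ n ]

  Alternating : List Syllable → Set
  Alternating = Linked (_≢_ on base)

  exponent-suc : ∀ l n → exponent (l , 0) + exponent (l , n) ≡ exponent (l , suc n)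
  exponent-suc (_ , true) n = refl
  exponent-suc (_ , false) n = refl

  expand : List Syllable → Word
  expand = concatMap power

  magnus-power-inPowers : ∀ s → InPowersOf (base s) (magnus (power s))
  magnus-power-inPowers (l , n) = replicate-inPowers (suc n)
    where
    replicate-inPowers : ∀ k → InPowersOf (proj₁ l) (magnus (replicate k l))
    replicate-inPowers zero = 𝟙-inPowers (proj₁ l)
    replicate-inPowers (suc k) = ⊛-inPowers (magnusˡ-inPowers l) (replicate-inPowers k)

  magnusˡ-base : ∀ {c} σ → magnusˡ (c , σ) [ c ] ≡ exponent ((c , σ) , 0)
  magnusˡ-base {c} true = if-≟-refl c
  magnusˡ-base {c} false = if-≟-refl c

  magnus-power-base : ∀ s → magnus (power s) [ base s ] ≡ exponent s
  magnus-power-base ((c , σ) , n) = go n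
    where
    l = (c , σ)
    letter-base : magnusˡ l [ c ] ≡ exponent (l , 0)
    letter-base = magnusˡ-base σ
    step : ∀ w → magnus (l ∷ w) [ c ] ≡ magnusˡ l [ c ] + magnus w [ c ]
    step w = begin
      magnusˡ l [] * magnus w [ c ] + magnusˡ l [ c ] * magnus w []
        ≡⟨ cong₂ (λ a b → a * magnus w [ c ] + magnusˡ l [ c ] * b)
                 (magnusˡ-constant l) (magnus-constant w) ⟩
      1ℤ * magnus w [ c ] + magnusˡ l [ c ] * 1ℤ
        ≡⟨ lemma (magnus w [ c ]) (magnusˡ l [ c ]) ⟩
      magnusˡ l [ c ] + magnus w [ c ] ∎
      where
      open ≡-Reasoning
      lemma : ∀ a b → 1ℤ * a + b * 1ℤ ≡ b + a
      lemma = solve-∀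
    go : ∀ n → magnus (power (l , n)) [ c ] ≡ exponent (l , n)
    go zero = trans (step []) (trans (+-identityʳ _) letter-base)
    go (suc n) = trans (step (power (l , n))) (trans (cong₂ _+_ letter-base (go n)) (exponent-suc l n))

  magnus-expand-vanishes : ∀ {L m} → Alternating L → Linked _≢_ m → length L < length m →
                           magnus (expand L) m ≡ 0ℤ
  magnus-expand-vanishes {[]} {_ ∷ _} _ _ _ = refl
  magnus-expand-vanishes {s ∷ L} {d ∷ m} alt altm (s≤s |L|<|m|) with base s ≟ d
  ... | yes refl = begin
    magnus (power s ++ expand L) (d ∷ m)
      ≡⟨ magnus-++ (power s) (expand L) (d ∷ m) ⟩
    (magnus (power s) ⊛ magnus (expand L)) (d ∷ m)
      ≡⟨ ⊛-inPowers-same (magnus (expand L)) (magnus-power-inPowers s) altm ⟩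
    magnus (power s) [] * magnus (expand L) (d ∷ m) + magnus (power s) [ d ] * magnus (expand L) m
      ≡⟨ cong₂ (λ a b → magnus (power s) [] * a + magnus (power s) [ d ] * b)
               (magnus-expand-vanishes (Linked.tail alt) altm (ℕ.m<n⇒m<1+n |L|<|m|))
               (magnus-expand-vanishes (Linked.tail alt) (Linked.tail altm) |L|<|m|) ⟩
    magnus (power s) [] * 0ℤ + magnus (power s) [ d ] * 0ℤ
      ≡⟨ cong₂ _+_ (*-zeroʳ (magnus (power s) [])) (*-zeroʳ (magnus (power s) [ d ])) ⟩
    0ℤ ∎
    where open ≡-Reasoning
  ... | no base≢d = begin
    magnus (power s ++ expand L) (d ∷ m)
      ≡⟨ magnus-++ (power s) (expand L) (d ∷ m) ⟩
    (magnus (power s) ⊛ magnus (expand L)) (d ∷ m)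
      ≡⟨ ⊛-inPowers-other (magnus (expand L)) (magnus-power-inPowers s) base≢d ⟩
    magnus (power s) [] * magnus (expand L) (d ∷ m)
      ≡⟨ cong (magnus (power s) [] *_)
              (magnus-expand-vanishes (Linked.tail alt) altm (ℕ.m<n⇒m<1+n |L|<|m|)) ⟩
    magnus (power s) [] * 0ℤ
      ≡⟨ *-zeroʳ (magnus (power s) []) ⟩
    0ℤ ∎
    where open ≡-Reasoning

  exponent≢0 : ∀ s → exponent s ≢ 0ℤ
  exponent≢0 ((_ , true) , _) ()
  exponent≢0 ((_ , false) , _) ()

  magnus-expand-leading : ∀ s {L} → Alternating (s ∷ L) →
                          magnus (expand (s ∷ L)) (map base (s ∷ L)) ≡
                          exponent s * magnus (expand L) (map base L)
  magnus-expand-leading s {L} alt = begin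
    magnus (power s ++ expand L) (base s ∷ map base L)
      ≡⟨ magnus-++ (power s) (expand L) (base s ∷ map base L) ⟩
    (f ⊛ g) (base s ∷ map base L)
      ≡⟨ ⊛-inPowers-same g (magnus-power-inPowers s) (map⁺ alt) ⟩
    f [] * g (base s ∷ map base L) + f [ base s ] * g (map base L)
      ≡⟨ cong₂ (λ a b → f [] * a + b * g (map base L))
               (magnus-expand-vanishes (Linked.tail alt) (map⁺ alt)
                                       (s≤s (ℕ.≤-reflexive (sym (length-map base L)))))
               (magnus-power-base s) ⟩
    f [] * 0ℤ + exponent s * g (map base L)
      ≡⟨ cong (_+ exponent s * g (map base L)) (*-zeroʳ (f [])) ⟩
    0ℤ + exponent s * g (map base L)
      ≡⟨ +-identityˡ _ ⟩
    exponent s * g (map base L) ∎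
    where
    open ≡-Reasoning
    f = magnus (power s)
    g = magnus (expand L)

  magnus-expand-bases : ∀ {L} → Alternating L → magnus (expand L) (map base L) ≢ 0ℤ
  magnus-expand-bases {[]} [] ()
  magnus-expand-bases {s ∷ L} alt coeff≡0
    with i*j≡0⇒i≡0∨j≡0 (exponent s) (trans (sym (magnus-expand-leading s alt)) coeff≡0)
  ... | inj₁ exponent≡0 = exponent≢0 s exponent≡0
  ... | inj₂ tail≡0 = magnus-expand-bases (Linked.tail alt) tail≡0

  same-base⇒equal : ∀ {l l′ : Letter} → proj₁ l ≡ proj₁ l′ → l′ ≢ l ⁻ → l′ ≡ l
  same-base⇒equal {_ , true} {_ , true} refl _ = refl
  same-base⇒equal {_ , false} {_ , false} refl _ = refl
  same-base⇒equal {_ , true} {_ , false} refl l′≢l⁻ = ⊥-elim (l′≢l⁻ refl)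
  same-base⇒equal {_ , false} {_ , true} refl l′≢l⁻ = ⊥-elim (l′≢l⁻ refl)

  syllables : ∀ {u} → Reduced u → Σ (List Syllable) λ L → Alternating L × expand L ≡ u
  syllables {[]} _ = [] , [] , refl
  syllables {l ∷ u} r with syllables (Linked.tail r)
  ... | [] , _ , refl = [ l , 0 ] , [-] , refl
  ... | (l′ , n) ∷ L , alt , refl with proj₁ l ≟ proj₁ l′
  ...   | no l≢l′ = (l , 0) ∷ (l′ , n) ∷ L , l≢l′ ∷ alt , refl
  ...   | yes l≡l′ with same-base⇒equal l≡l′ (Linked.head r)
  ...     | refl = (l , suc n) ∷ L , longer alt , refl
    where
    longer : ∀ {L} → Alternating ((l , n) ∷ L) → Alternating ((l , suc n) ∷ L)
    longer [-] = [-]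
    longer (≢ ∷ alt) = ≢ ∷ alt

  magnus-≢𝟙 : ∀ {u} → Reduced u → u ≢ [] → ∃ λ m → magnus u m ≢ 𝟙 m
  magnus-≢𝟙 r u≢[] with syllables r
  ... | [] , _ , refl = ⊥-elim (u≢[] refl)
  ... | L@(_ ∷ _) , alt , refl = map base L , magnus-expand-bases alt

  magnus-quotient : ∀ {x} y → Reduced x →
                    magnus (y · x ⁻¹ʷ) ⊖ 𝟙 ≗ (magnus y ⊖ magnus x) ⊛ magnus (x ⁻¹ʷ)
  magnus-quotient {x} y rx m = begin
    magnus (y · x ⁻¹ʷ) m - 𝟙 m
      ≡⟨ cong₂ _-_ (magnus-· y (x ⁻¹ʷ) m)
                   (trans (cong (λ w → magnus w m) (sym (⁻¹ʷ-inverseʳ rx))) (magnus-· x (x ⁻¹ʷ) m)) ⟩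
    (magnus y ⊛ magnus (x ⁻¹ʷ)) m - (magnus x ⊛ magnus (x ⁻¹ʷ)) m
      ≡⟨ ⊛-distribʳ-⊖ (magnus y) (magnus x) (magnus (x ⁻¹ʷ)) m ⟨
    ((magnus y ⊖ magnus x) ⊛ magnus (x ⁻¹ʷ)) m ∎
    where open ≡-Reasoning

  magnus-separates : ∀ {x y} → Reduced x → Reduced y → x ≢ y → ∃ λ m → magnus x m ≢ magnus y m
  magnus-separates {x} {y} rx ry x≢y with magnus-≢𝟙 (·-reduced y (⁻¹ʷ-reduced x)) quotient≢[]
    where
    quotient≢[] : y · x ⁻¹ʷ ≢ []
    quotient≢[] ≡[] = x≢y (sym (x∙y⁻¹≈ε⇒x≈y freeGroup (y , ry) (x , rx) ≡[]))
  ... | m , quotient≢𝟙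
    with ⊛-≢0⇒≢0ˡ (magnus y ⊖ magnus x) (magnus (x ⁻¹ʷ)) m
                 (λ ≡0 → quotient≢𝟙 (i-j≡0⇒i≡j _ _ (trans (magnus-quotient y rx m) ≡0)))
  ... | m′ , difference≢0 = m′ , λ x≡y → difference≢0 (i≡j⇒i-j≡0 (sym x≡y))

module _ where

  open import Data.Nat using (_+_)
  open ≡ using (refl)

  least-witness : ∀ {P : ℕ → Set} → (∀ n → Dec (P n)) → ∀ {n} → P n →
                  ∃ λ j → P j × (∀ {i} → i < j → ¬ P i)
  least-witness {P} P? {n} pn = search 0 n (λ ()) (≡.subst P (≡.sym (ℕ.+-identityʳ n)) pn)
    where
    search : ∀ k d → (∀ {i} → i < k → ¬ P i) → P (d + k) → ∃ λ j → P j × (∀ {i} → i < j → ¬ P i)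
    search k d below pd with P? k
    ... | yes pk = k , pk , below
    search k zero below pk | no ¬pk = ⊥-elim (¬pk pk)
    search k (suc d) below pd | no ¬pk = search (suc k) d below′ (≡.subst P (≡.sym (ℕ.+-suc d k)) pd)
      where
      below′ : ∀ {i} → i < suc k → ¬ P i
      below′ i<1+k with ℕ.m<1+n⇒m<n∨m≡n i<1+k
      ... | inj₁ i<k = below i<k
      ... | inj₂ refl = ¬pk

module SeriesOrder {X : Set} (monomial : ℕ → List X) (index : List X → ℕ)
                   (monomial-index : ∀ m → monomial (index m) ≡ m)
                   (degree-monotone : ∀ {j n} → j ≤ n → length (monomial j) ≤ length (monomial n)) where

  open FormalSeries X
  open ≡ using (refl; sym; trans; cong; cong₂; subst)
  open import Data.Integer as ℤ using (ℤ; _+_; _*_; -_; _-_; 0ℤ; 1ℤ)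
  import Data.Integer.Properties as ℤ
  open import Data.Integer.Tactic.RingSolver using (solve-∀)
  open import Relation.Binary.Definitions using (tri<; tri≈; tri>)
  open import Relation.Nullary using (¬?)
  open import Relation.Nullary.Decidable using (decidable-stable)

  LeadsAt : Series → ℕ → Set
  LeadsAt D n = (∀ {j} → j < n → D (monomial j) ≡ 0ℤ) × 0ℤ ℤ.< D (monomial n)

  infix 4 _<ˢ_
  record _<ˢ_ (f g : Series) : Set where
    constructor leading
    field
      {position} : ℕ
      leads : LeadsAt (g ⊖ f) position

  VanishesBelow : Series → ℕ → Set
  VanishesBelow D d = ∀ m → length m < d → D m ≡ 0ℤ

  leadsAt-cong : ∀ {D D′ n} → D ≗ D′ → LeadsAt D n → LeadsAt D′ n
  leadsAt-cong {n = n} D≗D′ (below , lead) =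
    (λ j<n → trans (sym (D≗D′ _)) (below j<n)) , subst (0ℤ ℤ.<_) (D≗D′ (monomial n)) lead

  leadsAt⇒vanishesBelow : ∀ {D n} → LeadsAt D n → VanishesBelow D (length (monomial n))
  leadsAt⇒vanishesBelow {D} {n} (below , _) m |m|<d with index m ℕ.<? n
  ... | yes index<n = subst (λ m → D m ≡ 0ℤ) (monomial-index m) (below index<n)
  ... | no index≮n = ⊥-elim (ℕ.<⇒≱ |m|<d
          (subst (λ m → length (monomial n) ≤ length m) (monomial-index m) (degree-monotone (ℕ.≮⇒≥ index≮n))))

  ⊛-vanishesBelow : ∀ {D d} g → VanishesBelow D d → VanishesBelow (g ⊛ D) d
  ⊛-vanishesBelow {D} g D≈0 [] d>0 = trans (cong (g [] *_) (D≈0 [] d>0)) (ℤ.*-zeroʳ (g []))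
  ⊛-vanishesBelow {D} g D≈0 (c ∷ m) |m|<d =
    trans (cong₂ (λ a b → g [] * a + b) (D≈0 (c ∷ m) |m|<d)
                 (⊛-vanishesBelow (∂ c g) D≈0 m (ℕ.<-trans (ℕ.n<1+n _) |m|<d)))
          (trans (ℤ.+-identityʳ _) (ℤ.*-zeroʳ (g [])))

  ⊛-low-degreeˡ : ∀ {D d} h {m} → VanishesBelow D d → length m ≤ d → (h ⊛ D) m ≡ h [] * D m
  ⊛-low-degreeˡ h {[]} D≈0 _ = refl
  ⊛-low-degreeˡ {D} h {c ∷ m} D≈0 |m|<d =
    trans (cong (h [] * D (c ∷ m) +_) (⊛-vanishesBelow (∂ c h) D≈0 m |m|<d)) (ℤ.+-identityʳ _)

  ⊛-low-degreeʳ : ∀ {E d} g {m} → VanishesBelow E d → length m ≤ d → (E ⊛ g) m ≡ E m * g []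
  ⊛-low-degreeʳ g {[]} E≈0 _ = refl
  ⊛-low-degreeʳ {E} {suc d} g {c ∷ m} E≈0 (s≤s |m|≤d) =
    trans (cong₂ (λ a b → a * g (c ∷ m) + b) (E≈0 [] (s≤s z≤n))
                 (⊛-low-degreeʳ g (λ m′ |m′|<d → E≈0 (c ∷ m′) (s≤s |m′|<d)) |m|≤d))
          (ℤ.+-identityˡ (E (c ∷ m) * g []))

  leadsAt-unipotent : ∀ {D n} h g → h [] ≡ 1ℤ → g [] ≡ 1ℤ → LeadsAt D n → LeadsAt (h ⊛ D ⊛ g) n
  leadsAt-unipotent {D} {n} h g h[]≡1 g[]≡1 lead@(below , positive) =
    (λ {j} j<n → trans (agree (monomial j) (degree-monotone (ℕ.<⇒≤ j<n))) (below j<n)) ,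
    subst (0ℤ ℤ.<_) (sym (agree (monomial n) ℕ.≤-refl)) positive
    where
    d = length (monomial n)
    D≈0 = leadsAt⇒vanishesBelow lead
    hD≈D : ∀ m → length m ≤ d → (h ⊛ D) m ≡ D m
    hD≈D m |m|≤d = trans (⊛-low-degreeˡ h D≈0 |m|≤d)
                           (trans (cong (_* D m) h[]≡1) (ℤ.*-identityˡ (D m)))
    hD≈0 : VanishesBelow (h ⊛ D) d
    hD≈0 m |m|<d = trans (hD≈D m (ℕ.<⇒≤ |m|<d)) (D≈0 m |m|<d)
    agree : ∀ m → length m ≤ d → (h ⊛ D ⊛ g) m ≡ D m
    agree m |m|≤d = trans (⊛-low-degreeʳ g {m} hD≈0 |m|≤d)
                            (trans (cong ((h ⊛ D) m *_) g[]≡1) (trans (ℤ.*-identityʳ _) (hD≈D m |m|≤d)))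

  leadsAt-⊕ : ∀ {D D′ n n′} → LeadsAt D n → LeadsAt D′ n′ → ∃ (LeadsAt (D ⊕ D′))
  leadsAt-⊕ {D} {D′} {n} {n′} (below , pos) (below′ , pos′) with ℕ.<-cmp n n′
  ... | tri< n<n′ _ _ = n ,
        (λ j<n → cong₂ _+_ (below j<n) (below′ (ℕ.<-trans j<n n<n′))) ,
        subst (0ℤ ℤ.<_) (sym (trans (cong (D (monomial n) +_) (below′ n<n′)) (ℤ.+-identityʳ _))) pos
  ... | tri≈ _ refl _ = n ,
        (λ j<n → cong₂ _+_ (below j<n) (below′ j<n)) ,
        ℤ.+-mono-< pos pos′
  ... | tri> _ _ n′<n = n′ ,
        (λ j<n′ → cong₂ _+_ (below (ℕ.<-trans j<n′ n′<n)) (below′ j<n′)) ,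
        subst (0ℤ ℤ.<_) (sym (trans (cong (_+ D′ (monomial n′)) (below n′<n)) (ℤ.+-identityˡ _))) pos′

  <ˢ-trans : ∀ {f g h} → f <ˢ g → g <ˢ h → f <ˢ h
  <ˢ-trans {f} {g} {h} (leading f<g) (leading g<h) with leadsAt-⊕ {h ⊖ g} {g ⊖ f} g<h f<g
  ... | _ , lead = leading (leadsAt-cong telescope lead)
    where
    telescope : (h ⊖ g) ⊕ (g ⊖ f) ≗ h ⊖ f
    telescope m = lemma (h m) (g m) (f m)
      where
      lemma : ∀ a b c → (a - b) + (b - c) ≡ a - c
      lemma = solve-∀

  private
    neg-difference : ∀ a b → - (a - b) ≡ b - a
    neg-difference = solve-∀

    swap : ∀ a b → a - b ≡ 0ℤ → b - a ≡ 0ℤ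
    swap a b a-b≡0 = trans (sym (neg-difference a b)) (cong -_ a-b≡0)

  <ˢ-asym : ∀ {f g} → f <ˢ g → ¬ g <ˢ f
  <ˢ-asym {f} {g} (leading {n} (below , pos)) (leading {n′} (below′ , pos′)) with ℕ.<-cmp n n′
  ... | tri< n<n′ _ _ = ℤ.<-irrefl (sym (swap (f (monomial n)) (g (monomial n)) (below′ n<n′))) pos
  ... | tri≈ _ refl _ =
    ℤ.<-asym pos (subst (ℤ._< 0ℤ) (neg-difference (f (monomial n)) (g (monomial n))) (ℤ.neg-mono-< pos′))
  ... | tri> _ _ n′<n = ℤ.<-irrefl (sym (swap (g (monomial n′)) (f (monomial n′)) (below n′<n))) pos′

  <ˢ-conj : ∀ {f f′} h g → h [] ≡ 1ℤ → g [] ≡ 1ℤ → f <ˢ f′ → h ⊛ f ⊛ g <ˢ h ⊛ f′ ⊛ g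
  <ˢ-conj {f} {f′} h g h[]≡1 g[]≡1 (leading lead) =
    leading (leadsAt-cong distrib (leadsAt-unipotent h g h[]≡1 g[]≡1 lead))
    where
    distrib : h ⊛ (f′ ⊖ f) ⊛ g ≗ h ⊛ f′ ⊛ g ⊖ h ⊛ f ⊛ g
    distrib m = trans (⊛-cong (⊛-distribˡ-⊖ h f′ f) (λ _ → refl) m) (⊛-distribʳ-⊖ (h ⊛ f′) (h ⊛ f) g m)

  <ˢ-connex : ∀ {f g} m → f m ≢ g m → f <ˢ g ⊎ g <ˢ f
  <ˢ-connex {f} {g} m fm≢gm with least-witness (λ j → ¬? (D (monomial j) ℤ.≟ 0ℤ)) {index m} Dm≢0
    where
    D = g ⊖ f
    Dm≢0 : D (monomial (index m)) ≢ 0ℤ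
    Dm≢0 rewrite monomial-index m = λ gm-fm≡0 → fm≢gm (sym (ℤ.i-j≡0⇒i≡j (g m) (f m) gm-fm≡0))
  ... | j , Dj≢0 , below with ℤ.<-cmp 0ℤ ((g ⊖ f) (monomial j))
  ...   | tri< 0<Dj _ _ = inj₁ (leading (vanish , 0<Dj))
    where
    vanish : ∀ {i} → i < j → (g ⊖ f) (monomial i) ≡ 0ℤ
    vanish i<j = decidable-stable (_ ℤ.≟ 0ℤ) (below i<j)
  ...   | tri≈ _ 0≡Dj _ = ⊥-elim (Dj≢0 (sym 0≡Dj))
  ...   | tri> _ _ Dj<0 =
    inj₂ (leading (vanish , subst (0ℤ ℤ.<_) (neg-difference (g (monomial j)) (f (monomial j))) (ℤ.neg-mono-< Dj<0)))
    where
    vanish : ∀ {i} → i < j → (f ⊖ g) (monomial i) ≡ 0ℤ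
    vanish {i} i<j = swap (g (monomial i)) (f (monomial i)) (decidable-stable (_ ℤ.≟ 0ℤ) (below i<j))

  <ˢ-resp-≗ : ∀ {f f′ g g′} → f ≗ f′ → g ≗ g′ → f <ˢ g → f′ <ˢ g′
  <ˢ-resp-≗ f≗f′ g≗g′ (leading lead) = leading (leadsAt-cong (λ m → cong₂ _-_ (g≗g′ m) (f≗f′ m)) lead)

module BinaryEnumeration where

  open ≡ using (refl; trans; cong; subst)
  open import Data.Nat using (_+_; _∸_)

  -- Successor in bijective base 2 (digits false = 1, true = 2, least significant first):
  -- iterating it from [] lists every monomial, shorter ones first.
  next : List Bool → List Bool
  next [] = false ∷ []
  next (false ∷ m) = true ∷ m
  next (true ∷ m) = false ∷ next m

  monomialᵇ : ℕ → List Bool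
  monomialᵇ zero = []
  monomialᵇ (suc n) = next (monomialᵇ n)

  indexᵇ : List Bool → ℕ
  indexᵇ [] = 0
  indexᵇ (false ∷ m) = suc (indexᵇ m + indexᵇ m)
  indexᵇ (true ∷ m) = suc (suc (indexᵇ m + indexᵇ m))

  monomialᵇ-odd : ∀ k → monomialᵇ (suc (k + k)) ≡ false ∷ monomialᵇ k
  monomialᵇ-odd zero = refl
  monomialᵇ-odd (suc k) rewrite ℕ.+-suc k k | monomialᵇ-odd k = refl

  monomialᵇ-indexᵇ : ∀ m → monomialᵇ (indexᵇ m) ≡ m
  monomialᵇ-indexᵇ [] = refl
  monomialᵇ-indexᵇ (false ∷ m) = trans (monomialᵇ-odd (indexᵇ m)) (cong (false ∷_) (monomialᵇ-indexᵇ m))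
  monomialᵇ-indexᵇ (true ∷ m) =
    trans (cong next (monomialᵇ-odd (indexᵇ m))) (cong (true ∷_) (monomialᵇ-indexᵇ m))

  length-next : ∀ m → length m ≤ length (next m)
  length-next [] = z≤n
  length-next (false ∷ m) = ℕ.≤-refl
  length-next (true ∷ m) = s≤s (length-next m)

  length-monomialᵇ-mono : ∀ {j n} → j ≤ n → length (monomialᵇ j) ≤ length (monomialᵇ n)
  length-monomialᵇ-mono {j} {n} j≤n =
    subst (λ n → length (monomialᵇ j) ≤ length (monomialᵇ n)) (ℕ.m∸n+n≡m j≤n) (go (n ∸ j))
    where
    go : ∀ k → length (monomialᵇ j) ≤ length (monomialᵇ (k + j))
    go zero = ℕ.≤-refl
    go (suc k) = ℕ.≤-trans (go k) (length-next (monomialᵇ (k + j)))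

module OrderedFreeGroup {X : Set} (_≟_ : DecidableEquality X)
                        (monomial : ℕ → List X) (index : List X → ℕ)
                        (monomial-index : ∀ m → monomial (index m) ≡ m)
                        (degree-monotone : ∀ {j n} → j ≤ n → length (monomial j) ≤ length (monomial n)) where

  open ≡ using (refl; sym; trans; cong; subst)
  open import Data.List.Properties using (≡-dec)
  open FreeGroup _≟_
  open Magnus _≟_
  open FormalSeries X
  open SeriesOrder monomial index monomial-index degree-monotone
  open Group freeGroup using (Carrier; _≈_; _∙_)

  infix 4 _<ᶠ_ _≤ᶠ_
  _<ᶠ_ : Rel Carrier 0ℓ
  x <ᶠ y = magnus (proj₁ x) <ˢ magnus (proj₁ y)

  _≤ᶠ_ : Rel Carrier 0ℓ
  x ≤ᶠ y = x ≈ y ⊎ x <ᶠ y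

  ≤ᶠ-trans : ∀ {x y z} → x ≤ᶠ y → y ≤ᶠ z → x ≤ᶠ z
  ≤ᶠ-trans (inj₁ x≈y) (inj₁ y≈z) = inj₁ (trans x≈y y≈z)
  ≤ᶠ-trans {z = z} (inj₁ x≈y) (inj₂ y<z) = inj₂ (subst (λ w → magnus w <ˢ magnus (proj₁ z)) (sym x≈y) y<z)
  ≤ᶠ-trans {x} (inj₂ x<y) (inj₁ y≈z) = inj₂ (subst (λ w → magnus (proj₁ x) <ˢ magnus w) y≈z x<y)
  ≤ᶠ-trans (inj₂ x<y) (inj₂ y<z) = inj₂ (<ˢ-trans x<y y<z)

  ≤ᶠ-antisym : ∀ {x y} → x ≤ᶠ y → y ≤ᶠ x → x ≈ y
  ≤ᶠ-antisym (inj₁ x≈y) _ = x≈y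
  ≤ᶠ-antisym (inj₂ _) (inj₁ y≈x) = sym y≈x
  ≤ᶠ-antisym (inj₂ x<y) (inj₂ y<x) with <ˢ-asym x<y y<x
  ... | ()

  ≤ᶠ-total : ∀ x y → x ≤ᶠ y ⊎ y ≤ᶠ x
  ≤ᶠ-total (x , rx) (y , ry) with ≡-dec _≟ˡ_ x y
  ... | yes x≡y = inj₁ (inj₁ x≡y)
  ... | no x≢y with magnus-separates rx ry x≢y
  ...   | m , differ with <ˢ-connex {magnus x} {magnus y} m differ
  ...     | inj₁ x<y = inj₁ (inj₂ x<y)
  ...     | inj₂ y<x = inj₂ (inj₂ y<x)

  ≤ᶠ-bi-invariant : ∀ a b x y → a ≤ᶠ b → (x ∙ a) ∙ y ≤ᶠ (x ∙ b) ∙ y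
  ≤ᶠ-bi-invariant _ _ (x , _) (y , _) (inj₁ a≈b) = inj₁ (cong (λ w → (x · w) · y) a≈b)
  ≤ᶠ-bi-invariant (a , _) (b , _) (x , _) (y , _) (inj₂ a<b) =
    inj₂ (<ˢ-resp-≗ (sandwich a) (sandwich b)
           (<ˢ-conj (magnus x) (magnus y) (magnus-constant x) (magnus-constant y) a<b))
    where
    sandwich : ∀ w → magnus x ⊛ magnus w ⊛ magnus y ≗ magnus ((x · w) · y)
    sandwich w m = sym (trans (magnus-· (x · w) y m) (⊛-cong (magnus-· x w) (λ _ → refl) m))

  isOrderedGroup : IsOrderedGroup freeGroup _≤ᶠ_
  isOrderedGroup = record
    { isPartialOrder = record
      { isPreorder = record
        { isEquivalence = Group.isEquivalence freeGroup
        ; reflexive = inj₁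
        ; trans = λ {x} {y} {z} → ≤ᶠ-trans {x} {y} {z}
        }
      ; antisym = λ {x} {y} → ≤ᶠ-antisym {x} {y}
      }
    ; total = ≤ᶠ-total
    } , ≤ᶠ-bi-invariant

module DerivedSeries (G : Group 0ℓ 0ℓ) where

  open Group G
  open import Data.Unit using (tt)

  ⁅_,_⁆ : Carrier → Carrier → Carrier
  ⁅ u , v ⁆ = ((u ⁻¹ ∙ v ⁻¹) ∙ u) ∙ v

  derived-∙ : ∀ n {x y} → Derived G n x → Derived G n y → Derived G n (x ∙ y)
  derived-∙ zero _ _ = tt
  derived-∙ (suc n) dx dy = gen-∙ dx dy

  derived-⁅,⁆ : ∀ n {u v} → Derived G n u → Derived G n v → Derived G (suc n) ⁅ u , v ⁆
  derived-⁅,⁆ n du dv = gen-incl (_ , _ , du , dv , refl)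

  commutator-sequence : Carrier → Carrier → ℕ → Carrier × Carrier
  commutator-sequence a b zero = a , b
  commutator-sequence a b (suc n) with commutator-sequence a b n
  ... | x , y = ⁅ y , x ∙ y ⁆ , ⁅ x , y ∙ x ⁆

  commutator-sequence-derived : ∀ a b n → Derived G n (proj₁ (commutator-sequence a b n)) × Derived G n (proj₂ (commutator-sequence a b n))
  commutator-sequence-derived a b zero = tt , tt
  commutator-sequence-derived a b (suc n) with commutator-sequence a b n | commutator-sequence-derived a b n
  ... | x , y | dx , dy = derived-⁅,⁆ n dy (derived-∙ n dx dy) , derived-⁅,⁆ n dx (derived-∙ n dy dx)

  module _ {c ℓ} (M : Monoid c ℓ) {φ : Carrier → Monoid.Carrier M}
           (φ-hom : IsMonoidHomomorphism rawMonoid (Monoid.rawMonoid M) φ) where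

    private
      module M = Monoid M
      open IsMonoidHomomorphism φ-hom
    open import Relation.Binary.Reasoning.Setoid M.setoid

    φ-⁻¹-cong : ∀ {u u′} → φ u M.≈ φ u′ → φ (u ⁻¹) M.≈ φ (u′ ⁻¹)
    φ-⁻¹-cong {u} {u′} φu≈φu′ = begin
      φ (u ⁻¹)                         ≈⟨ M.identityʳ _ ⟨
      φ (u ⁻¹) M.∙ M.ε                 ≈⟨ M.∙-congˡ (M.trans (⟦⟧-cong (inverseʳ u′)) ε-homo) ⟨
      φ (u ⁻¹) M.∙ φ (u′ ∙ u′ ⁻¹)      ≈⟨ M.∙-congˡ (homo u′ (u′ ⁻¹)) ⟩
      φ (u ⁻¹) M.∙ (φ u′ M.∙ φ (u′ ⁻¹)) ≈⟨ M.∙-congˡ (M.∙-congʳ φu≈φu′) ⟨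
      φ (u ⁻¹) M.∙ (φ u M.∙ φ (u′ ⁻¹))  ≈⟨ M.assoc _ _ _ ⟨
      (φ (u ⁻¹) M.∙ φ u) M.∙ φ (u′ ⁻¹)  ≈⟨ M.∙-congʳ (homo (u ⁻¹) u) ⟨
      φ (u ⁻¹ ∙ u) M.∙ φ (u′ ⁻¹)       ≈⟨ M.∙-congʳ (M.trans (⟦⟧-cong (inverseˡ u)) ε-homo) ⟩
      M.ε M.∙ φ (u′ ⁻¹)                ≈⟨ M.identityˡ _ ⟩
      φ (u′ ⁻¹)                        ∎

    φ-∙-cong : ∀ {u u′ v v′} → φ u M.≈ φ u′ → φ v M.≈ φ v′ → φ (u ∙ v) M.≈ φ (u′ ∙ v′)
    φ-∙-cong {u} {u′} {v} {v′} φu≈ φv≈ = M.trans (homo u v) (M.trans (M.∙-cong φu≈ φv≈) (M.sym (homo u′ v′)))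

    φ-⁅,⁆-cong : ∀ {u u′ v v′} → φ u M.≈ φ u′ → φ v M.≈ φ v′ → φ ⁅ u , v ⁆ M.≈ φ ⁅ u′ , v′ ⁆
    φ-⁅,⁆-cong φu≈ φv≈ = φ-∙-cong (φ-∙-cong (φ-∙-cong (φ-⁻¹-cong φu≈) (φ-⁻¹-cong φv≈)) φu≈) φv≈

    ¬soluble-from-image : ∀ a b → φ ⁅ b , a ∙ b ⁆ M.≈ φ a → φ ⁅ a , b ∙ a ⁆ M.≈ φ b →
                          ¬ φ a M.≈ M.ε → ¬ Soluble G
    ¬soluble-from-image a b φa-fixed φb-fixed φa≉ε (n , derived-trivial) = φa≉ε (begin
      φ a                         ≈⟨ proj₁ (images n) ⟨
      φ (proj₁ (commutator-sequence a b n))     ≈⟨ ⟦⟧-cong (derived-trivial _ (proj₁ (commutator-sequence-derived a b n))) ⟩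
      φ ε                         ≈⟨ ε-homo ⟩
      M.ε                         ∎)
      where
      images : ∀ n → φ (proj₁ (commutator-sequence a b n)) M.≈ φ a × φ (proj₂ (commutator-sequence a b n)) M.≈ φ b
      images zero = M.refl , M.refl
      images (suc n) with images n
      ... | φx≈φa , φy≈φb =
        M.trans (φ-⁅,⁆-cong φy≈φb (φ-∙-cong φx≈φa φy≈φb)) φa-fixed ,
        M.trans (φ-⁅,⁆-cong φx≈φa (φ-∙-cong φy≈φb φx≈φa)) φb-fixed

module ActionOnFivePoints where

  open import Data.Fin.Patterns using (0F; 1F; 2F; 3F; 4F)
  open import Data.Fin.Properties using (all?) renaming (_≟_ to _≟ᶠ_)
  open import Function.Endo.Setoid using (∘-id-monoid)
  open import Relation.Nullary.Decidable using (True; toWitness)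
  open FreeGroup _≟ᵇ_
  open DerivedSeries freeGroup using (¬soluble-from-image)

  by-computation : ∀ {n m} {f g : Fin n → Fin m} {p : True (all? λ i → f i ≟ᶠ g i)} → ∀ i → f i ≡ g i
  by-computation {p = p} = toWitness p

  -- Composition in this monoid is left to right, so lift is a right action of the free group;
  -- the relations α = ⁅ β , α β ⁆ and β = ⁅ α , β α ⁆ checked below hold in that convention.
  Endo₅ : Monoid 0ℓ 0ℓ
  Endo₅ = ∘-id-monoid (≡.setoid (Fin 5))

  endo : (Fin 5 → Fin 5) → Monoid.Carrier Endo₅
  endo f = record { to = f ; cong = ≡.cong f }

  α α⁻¹ β β⁻¹ : Fin 5 → Fin 5
  α 0F = 1F
  α 1F = 2F
  α 2F = 3F
  α 3F = 4F
  α 4F = 0F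
  α⁻¹ 0F = 4F
  α⁻¹ 1F = 0F
  α⁻¹ 2F = 1F
  α⁻¹ 3F = 2F
  α⁻¹ 4F = 3F
  β 0F = 1F
  β 1F = 3F
  β 2F = 0F
  β 3F = 4F
  β 4F = 2F
  β⁻¹ 0F = 2F
  β⁻¹ 1F = 0F
  β⁻¹ 2F = 4F
  β⁻¹ 3F = 1F
  β⁻¹ 4F = 3F

  image image⁻¹ : Bool → Monoid.Carrier Endo₅
  image false = endo α
  image true = endo β
  image⁻¹ false = endo α⁻¹
  image⁻¹ true = endo β⁻¹

  image-inverse : ∀ x → MutuallyInverse Endo₅ (image x) (image⁻¹ x)
  image-inverse false = by-computation , by-computation
  image-inverse true = by-computation , by-computation

  open Lift Endo₅ image image⁻¹ image-inverse using (lift-isMonoidHomomorphism)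

  freeGroup-¬soluble : ¬ Soluble freeGroup
  freeGroup-¬soluble =
    ¬soluble-from-image Endo₅ lift-isMonoidHomomorphism (generator false) (generator true)
      by-computation by-computation (λ α≈id → case α≈id 0F of λ ())

module Cardinality (G : Group 0ℓ 0ℓ) where

  open Group G
  open import Data.Fin using (splitAt; _↑ˡ_; _↑ʳ_)
  open import Data.Fin.Properties using (splitAt-↑ˡ; splitAt-↑ʳ; splitAt⁻¹-↑ˡ; splitAt⁻¹-↑ʳ)
  open import Data.Nat using (_+_)
  open import Data.Sum using ([_,_]′)

  image-hasSize : ∀ {k} (f : Fin k → Carrier) → InjectiveEnum G f → HasSize G (Image G f) k
  image-hasSize f f-injective = f , f-injective , (λ i → i , refl) , (λ _ x∈f → x∈f)

  hasSize-⇔ : ∀ {P Q : Carrier → Set} {m} → (∀ x → P x → Q x) → (∀ x → Q x → P x) →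
              HasSize G P m → HasSize G Q m
  hasSize-⇔ P⇒Q Q⇒P (f , f-injective , f∈P , P⊆f) =
    f , f-injective , (λ i → P⇒Q _ (f∈P i)) , (λ x qx → P⊆f x (Q⇒P x qx))

  hasSize-⊎ : ∀ {P Q : Carrier → Set} {m n} → HasSize G P m → HasSize G Q n →
              (∀ x y → P x → Q y → ¬ x ≈ y) → HasSize G (λ x → P x ⊎ Q x) (m + n)
  hasSize-⊎ {P} {Q} {m} {n} (f , f-injective , f∈P , P⊆f) (g , g-injective , g∈Q , Q⊆g) disjoint =
    h , h-injective , h∈ , ⊆h
    where
    h : Fin (m + n) → Carrier
    h i = [ f , g ]′ (splitAt m i)

    h∈ : ∀ i → P (h i) ⊎ Q (h i)
    h∈ i with splitAt m i
    ... | inj₁ i′ = inj₁ (f∈P i′)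
    ... | inj₂ i′ = inj₂ (g∈Q i′)

    h-injective : InjectiveEnum G h
    h-injective i j hi≈hj with splitAt m i in eqᵢ | splitAt m j in eqⱼ
    ... | inj₁ i′ | inj₁ j′ = ≡.trans (≡.sym (splitAt⁻¹-↑ˡ eqᵢ))
                                (≡.trans (≡.cong (_↑ˡ n) (f-injective i′ j′ hi≈hj)) (splitAt⁻¹-↑ˡ eqⱼ))
    ... | inj₂ i′ | inj₂ j′ = ≡.trans (≡.sym (splitAt⁻¹-↑ʳ eqᵢ))
                                (≡.trans (≡.cong (m ↑ʳ_) (g-injective i′ j′ hi≈hj)) (splitAt⁻¹-↑ʳ eqⱼ))
    ... | inj₁ i′ | inj₂ j′ = ⊥-elim (disjoint _ _ (f∈P i′) (g∈Q j′) hi≈hj)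
    ... | inj₂ i′ | inj₁ j′ = ⊥-elim (disjoint _ _ (f∈P j′) (g∈Q i′) (sym hi≈hj))

    ⊆h : ∀ x → P x ⊎ Q x → Σ (Fin (m + n)) λ i → x ≈ h i
    ⊆h x (inj₁ px) with P⊆f x px
    ... | i , x≈fi = i ↑ˡ n , ≡.subst (λ z → x ≈ [ f , g ]′ z) (≡.sym (splitAt-↑ˡ m i n)) x≈fi
    ⊆h x (inj₂ qx) with Q⊆g x qx
    ... | i , x≈gi = m ↑ʳ i , ≡.subst (λ z → x ≈ [ f , g ]′ z) (≡.sym (splitAt-↑ʳ m n i)) x≈gi

module _ where

  open import Data.List.Properties using (length-replicate; ∷-injectiveˡ; ∷-injectiveʳ)
  open import Data.Nat using (_+_)

  replicate-injective : ∀ {A : Set} {x : A} {m n} → replicate m x ≡ replicate n x → m ≡ n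
  replicate-injective {x = x} {m} {n} eq =
    ≡.trans (≡.sym (length-replicate m)) (≡.trans (≡.cong length eq) (length-replicate n))

  replicate-++ : ∀ {A : Set} (x : A) m n → replicate m x ++ replicate n x ≡ replicate (m + n) x
  replicate-++ x zero n = ≡.refl
  replicate-++ x (suc m) n = ≡.cong (x ∷_) (replicate-++ x m n)

  replicate≢replicate-++ : ∀ {A : Set} {x y : A} → x ≢ y → ∀ t p w → replicate t x ≢ replicate p x ++ y ∷ w
  replicate≢replicate-++ x≢y zero zero w ()
  replicate≢replicate-++ x≢y zero (suc p) w ()
  replicate≢replicate-++ x≢y (suc t) zero w eq = x≢y (∷-injectiveˡ eq)
  replicate≢replicate-++ x≢y (suc t) (suc p) w eq = replicate≢replicate-++ x≢y t p w (∷-injectiveʳ eq)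

module SmallDoubling (r : ℕ) where

  open FreeGroup _≟ᵇ_
  open Group freeGroup using (Carrier; _≈_; _∙_)
  open Cardinality freeGroup
  open import Data.Fin using (fromℕ; fromℕ<; splitAt; _↑ʳ_)
  open import Data.Fin.Properties
    using (toℕ-injective; toℕ-fromℕ; toℕ-fromℕ<; toℕ<n; splitAt⁻¹-↑ˡ; splitAt⁻¹-↑ʳ; toℕ-↑ˡ; toℕ-↑ʳ)
  open import Data.List.Properties using (∷-injectiveʳ; ++-cancelʳ)
  open import Data.Nat using (_+_; _*_; _∸_)
  open import Data.Nat.Tactic.RingSolver using (solve-∀)

  n : ℕ
  n = suc (suc r)

  wordS : Fin (suc n) → List Bool
  wordS zero = [ true ]
  wordS (suc i) = replicate (toℕ i) false

  S : Fin (suc n) → Carrier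
  S i = positive (wordS i)

  aᵗ≢aᵖbw : ∀ t p w → replicate t false ≢ replicate p false ++ true ∷ w
  aᵗ≢aᵖbw = replicate≢replicate-++ (λ ())

  S-injective : InjectiveEnum freeGroup S
  S-injective zero zero _ = ≡.refl
  S-injective zero (suc j) Si≈Sj = ⊥-elim (aᵗ≢aᵖbw (toℕ j) 0 [] (≡.sym (positive-injective Si≈Sj)))
  S-injective (suc i) zero Si≈Sj = ⊥-elim (aᵗ≢aᵖbw (toℕ i) 0 [] (positive-injective Si≈Sj))
  S-injective (suc i) (suc j) Si≈Sj =
    ≡.cong suc (toℕ-injective (replicate-injective (positive-injective Si≈Sj)))

  S-generates : ∀ g → Gen freeGroup (Image freeGroup S) g
  S-generates = generated-by-generators λ
    { false → gen-incl (suc (suc zero) , ≡.refl)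
    ; true → gen-incl (zero , ≡.refl)
    }

  wordA : Fin (n + suc r) → List Bool
  wordA t = replicate (toℕ t) false

  wordAB : Fin (suc r) → List Bool
  wordAB q = replicate (suc (toℕ q)) false ++ [ true ]

  wordBA : Fin n → List Bool
  wordBA q = true ∷ replicate (toℕ q) false

  wordBB : Fin 1 → List Bool
  wordBB _ = true ∷ true ∷ []

  familyA : Fin (n + suc r) → Carrier
  familyA = positive ∘ wordA

  familyAB : Fin (suc r) → Carrier
  familyAB = positive ∘ wordAB

  familyBA : Fin n → Carrier
  familyBA = positive ∘ wordBA

  familyBB : Fin 1 → Carrier
  familyBB = positive ∘ wordBB

  Families : Carrier → Set
  Families x = Image freeGroup familyA x ⊎ (Image freeGroup familyAB x ⊎
               (Image freeGroup familyBA x ⊎ Image freeGroup familyBB x))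

  square⇒families : ∀ x → Square freeGroup S x → Families x
  square⇒families x (i , j , x≈SiSj) = classify i j (≡.trans x≈SiSj (positive-∙ (wordS i) (wordS j)))
    where
    classify : ∀ i j → x ≈ positive (wordS i ++ wordS j) → Families x
    classify zero zero x≈ = inj₂ (inj₂ (inj₂ (zero , x≈)))
    classify zero (suc j) x≈ = inj₂ (inj₂ (inj₁ (j , x≈)))
    classify (suc zero) zero x≈ = inj₂ (inj₂ (inj₁ (zero , x≈)))
    classify (suc (suc i)) zero x≈ = inj₂ (inj₁ (i , x≈))
    classify (suc i) (suc j) x≈ = inj₁ (fromℕ< sum<bound , ≡.trans x≈ (≡.cong (proj₁ ∘ positive) exponent))
      where
      sum<bound : toℕ i + toℕ j < n + suc r
      sum<bound = s≤s (ℕ.+-mono-≤ (ℕ.≤-pred (toℕ<n i)) (ℕ.≤-pred (toℕ<n j)))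
      exponent : replicate (toℕ i) false ++ replicate (toℕ j) false ≡ wordA (fromℕ< sum<bound)
      exponent = ≡.trans (replicate-++ false (toℕ i) (toℕ j))
                         (≡.cong (λ t → replicate t false) (≡.sym (toℕ-fromℕ< sum<bound)))

  power-square : ∀ x (i j : Fin n) {p} → p ≡ toℕ i + toℕ j → x ≈ positive (replicate p false) →
                 Square freeGroup S x
  power-square x i j ≡.refl x≈ = suc i , suc j ,
    ≡.trans x≈ (≡.trans (≡.cong (proj₁ ∘ positive) (≡.sym (replicate-++ false (toℕ i) (toℕ j))))
                        (≡.sym (positive-∙ (wordS (suc i)) (wordS (suc j)))))

  familyA⇒square : ∀ x t → x ≈ familyA t → Square freeGroup S x
  familyA⇒square x t x≈ with splitAt n t in split
  ... | inj₁ i =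
    power-square x zero i (≡.trans (≡.sym (≡.cong toℕ (splitAt⁻¹-↑ˡ split))) (toℕ-↑ˡ i (suc r))) x≈
  ... | inj₂ j = power-square x (fromℕ (suc r)) (suc j) exponent x≈
    where
    exponent : toℕ t ≡ toℕ (fromℕ (suc r)) + suc (toℕ j)
    exponent = begin
      toℕ t                          ≡⟨ ≡.cong toℕ (splitAt⁻¹-↑ʳ split) ⟨
      toℕ (n ↑ʳ j)                   ≡⟨ toℕ-↑ʳ n j ⟩
      suc (suc (r + toℕ j))          ≡⟨ ≡.cong suc (ℕ.+-suc r (toℕ j)) ⟨
      suc r + suc (toℕ j)            ≡⟨ ≡.cong (_+ suc (toℕ j)) (toℕ-fromℕ (suc r)) ⟨
      toℕ (fromℕ (suc r)) + suc (toℕ j) ∎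
      where open ≡.≡-Reasoning

  families⇒square : ∀ x → Families x → Square freeGroup S x
  families⇒square x (inj₁ (t , x≈)) = familyA⇒square x t x≈
  families⇒square x (inj₂ (inj₁ (q , x≈))) =
    suc (suc q) , zero , ≡.trans x≈ (≡.sym (positive-∙ (wordS (suc (suc q))) (wordS zero)))
  families⇒square x (inj₂ (inj₂ (inj₁ (q , x≈)))) =
    zero , suc q , ≡.trans x≈ (≡.sym (positive-∙ (wordS zero) (wordS (suc q))))
  families⇒square x (inj₂ (inj₂ (inj₂ (_ , x≈)))) =
    zero , zero , ≡.trans x≈ (≡.sym (positive-∙ (wordS zero) (wordS zero)))

  familyA-injective : InjectiveEnum freeGroup familyA
  familyA-injective i j eq = toℕ-injective (replicate-injective (positive-injective eq))

  familyAB-injective : InjectiveEnum freeGroup familyAB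
  familyAB-injective i j eq =
    toℕ-injective (ℕ.suc-injective (replicate-injective (++-cancelʳ [ true ] _ _ (positive-injective eq))))

  familyBA-injective : InjectiveEnum freeGroup familyBA
  familyBA-injective i j eq = toℕ-injective (replicate-injective (∷-injectiveʳ (positive-injective eq)))

  familyBB-injective : InjectiveEnum freeGroup familyBB
  familyBB-injective zero zero _ = ≡.refl

  disjoint-words : ∀ {k l} (u : Fin k → List Bool) (v : Fin l → List Bool) → (∀ i j → u i ≢ v j) →
                   ∀ x y → Image freeGroup (positive ∘ u) x → Image freeGroup (positive ∘ v) y → ¬ x ≈ y
  disjoint-words _ _ u≢v _ _ (i , x≈) (j , y≈) x≈y =
    u≢v i j (positive-injective (≡.trans (≡.sym x≈) (≡.trans x≈y y≈)))

  A-disjoint : ∀ x y → Image freeGroup familyA x →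
               Image freeGroup familyAB y ⊎ (Image freeGroup familyBA y ⊎ Image freeGroup familyBB y) → ¬ x ≈ y
  A-disjoint x y a (inj₁ ab) =
    disjoint-words wordA wordAB (λ t q → aᵗ≢aᵖbw (toℕ t) (suc (toℕ q)) []) x y a ab
  A-disjoint x y a (inj₂ (inj₁ ba)) = disjoint-words wordA wordBA (λ t q → aᵗ≢aᵖbw (toℕ t) 0 _) x y a ba
  A-disjoint x y a (inj₂ (inj₂ bb)) = disjoint-words wordA wordBB (λ t _ → aᵗ≢aᵖbw (toℕ t) 0 _) x y a bb

  AB-disjoint : ∀ x y → Image freeGroup familyAB x →
                Image freeGroup familyBA y ⊎ Image freeGroup familyBB y → ¬ x ≈ y
  AB-disjoint x y ab (inj₁ ba) = disjoint-words wordAB wordBA (λ _ _ ()) x y ab ba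
  AB-disjoint x y ab (inj₂ bb) = disjoint-words wordAB wordBB (λ _ _ ()) x y ab bb

  BA-disjoint : ∀ x y → Image freeGroup familyBA x → Image freeGroup familyBB y → ¬ x ≈ y
  BA-disjoint = disjoint-words wordBA wordBB (λ q _ eq → aᵗ≢aᵖbw (toℕ q) 0 [] (∷-injectiveʳ eq))

  families-size : (n + suc r) + (suc r + (n + 1)) ≡ 4 * suc n ∸ 5
  families-size = ≡.sym (≡.trans (≡.cong (_∸ 5) (total r)) (ℕ.m+n∸m≡n 5 _))
    where
    total : ∀ r → 4 * suc (suc (suc r)) ≡ 5 + ((suc (suc r) + suc r) + (suc r + (suc (suc r) + 1)))
    total = solve-∀

  square-hasSize : HasSize freeGroup (Square freeGroup S) (4 * suc n ∸ 5)
  square-hasSize = ≡.subst (HasSize freeGroup (Square freeGroup S)) families-size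
    (hasSize-⇔ families⇒square square⇒families
      (hasSize-⊎ (image-hasSize familyA familyA-injective)
        (hasSize-⊎ (image-hasSize familyAB familyAB-injective)
          (hasSize-⊎ (image-hasSize familyBA familyBA-injective) (image-hasSize familyBB familyBB-injective)
            BA-disjoint)
          AB-disjoint)
        A-disjoint))

open import Data.Nat using (_*_; _∸_)

open FreeGroup _≟ᵇ_ using (freeGroup)
open BinaryEnumeration
open OrderedFreeGroup _≟ᵇ_ monomialᵇ indexᵇ monomialᵇ-indexᵇ length-monomialᵇ-mono
  using (_≤ᶠ_; isOrderedGroup)
open ActionOnFivePoints using (freeGroup-¬soluble)

theorem2p11 : Σ[ G ∈ Group 0ℓ 0ℓ ] Σ[ le ∈ Rel (Group.Carrier G) 0ℓ ]
    (IsOrderedGroup G le × ¬ Soluble G ×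
     (∀ (k : ℕ) → 3 ≤ k → Σ[ s ∈ (Fin k → Group.Carrier G) ]
        (InjectiveEnum G s × HasSize G (Square G s) (4 * k ∸ 5) × (∀ g → Gen G (Image G s) g))))
theorem2p11 = freeGroup , _≤ᶠ_ , isOrderedGroup , freeGroup-¬soluble ,
  λ { _ (s≤s (s≤s (s≤s {n = r} _))) →
        SmallDoubling.S r , SmallDoubling.S-injective r ,
        SmallDoubling.square-hasSize r , SmallDoubling.S-generates r }
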